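{- Let $k\geq 3$ be an integer and let $G=(\langle a\rangle\rtimes\langle b\rangle)\times\langle c\rangle\times\langle d\rangle$, where $|a|=k$, $|b|=|c|=|d|=2$ and $bab=a^{ -1}$. Let $A=\langle a\rangle$ and $$S=b(A\setminus\{a^{ -1}\})\cup c(A\cup\{b\})\cup\{db,\,dcba^{ -1}\},$$ and let $\Gamma=\mathrm{Cay}(G,S)$. Then $\Gamma$ is a strictly Deza graph with parameters $(8k,2(k+1),2(k-1),2)$, i.e. $\Gamma$ has $8k$ vertices, is $2(k+1)$-regular, every pair of distinct vertices has either $2(k-1)$ or $2$ common neighbours, $\Gamma$ is not strongly regular, and $\Gamma$ has diameter $2$.
   Context: For a finite group $G$ and an identity-free subset $S\subseteq G$ with $S=S^{ -1}$, the Cayley graph $\mathrm{Cay}(G,S)$ has vertex set $G$ and $g,h$ adjacent iff $hg^{ -1}\in S$ (arcs $(g,sg)$, $s\in S$). A $k$-regular graph on $n$ vertices is a Deza graph with parameters $(n,k,\beta,\alpha)$ if every pair of distinct vertices has either $\alpha$ or $\beta$ common neighbours. A strictly Deza graph is a Deza graph that is not strongly regular and has diameter $2$. -}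

module Defs where

open import Level using (0ℓ)
open import Data.Nat using (ℕ; zero; suc; NonZero; _∸_)
import Data.Nat as ℕ
open import Data.Nat.DivMod using (_mod_)
open import Data.Fin using (Fin; toℕ)
import Data.Fin.Properties as FinP
open import Data.Bool using (Bool; true; false; _xor_; if_then_else_)
import Data.Bool.Properties as BoolP
open import Data.Product using (Σ; Σ-syntax; ∃; _×_; _,_)
open import Data.Product.Properties using (≡-dec)
open import Data.Sum using (_⊎_)
open import Data.List using (List; []; _∷_; _++_; map; filter; length; allFin; cartesianProduct)
open import Data.List.Membership.DecPropositional using () renaming (_∈?_ to ∈?-of)
import Data.List.Membership.Propositional as Mem
open import Relation.Nullary using (¬_; Dec; yes; no; _×-dec_)
open import Relation.Unary using (Pred)
open import Relation.Binary using (Rel; Decidable; DecidableEquality)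
open import Relation.Binary.PropositionalEquality using (_≡_; _≢_)

-- Finite simple graphs given by an explicit list of all vertices
-- (each vertex listed exactly once) and a decidable adjacency relation.

record FinGraph : Set₁ where
  field
    V        : Set
    vertices : List V
    _~_      : Rel V 0ℓ
    _~?_     : Decidable _~_

module _ (Γ : FinGraph) where
  open FinGraph Γ

  order : ℕ
  order = length vertices

  degree : V → ℕ
  degree x = length (filter (x ~?_) vertices)

  commonNbrs : V → V → ℕ
  commonNbrs x y = length (filter (λ z → (x ~? z) ×-dec (y ~? z)) vertices)

  IsRegular : ℕ → Set
  IsRegular r = ∀ x → degree x ≡ r

  IsDeza : ℕ → ℕ → ℕ → ℕ → Set
  IsDeza n r β α =
    order ≡ n × IsRegular r ×
    (∀ x y → x ≢ y → commonNbrs x y ≡ α ⊎ commonNbrs x y ≡ β)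

  IsSRGWith : ℕ → ℕ → ℕ → ℕ → Set
  IsSRGWith n r l m =
    order ≡ n × IsRegular r ×
    (∀ x y → x ≢ y → x ~ y → commonNbrs x y ≡ l) ×
    (∀ x y → x ≢ y → ¬ (x ~ y) → commonNbrs x y ≡ m)

  IsStronglyRegular : Set
  IsStronglyRegular = Σ[ n ∈ ℕ ] Σ[ r ∈ ℕ ] Σ[ l ∈ ℕ ] Σ[ m ∈ ℕ ] IsSRGWith n r l m

  HasDiameter2 : Set
  HasDiameter2 =
    (∀ x y → x ≢ y → (x ~ y) ⊎ (Σ[ z ∈ V ] (x ~ z × z ~ y))) ×
    (Σ[ x ∈ V ] Σ[ y ∈ V ] (x ≢ y × ¬ (x ~ y)))

  IsStrictlyDeza : ℕ → ℕ → ℕ → ℕ → Set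
  IsStrictlyDeza n r β α = IsDeza n r β α × ¬ IsStronglyRegular × HasDiameter2

-- The group G = (⟨a⟩ ⋊ ⟨b⟩) × ⟨c⟩ × ⟨d⟩ with |a| = k, |b|=|c|=|d| = 2,
-- bab = a⁻¹.  The element (i , e , f , g) stands for a^i b^e c^f d^g.

module Construction (k : ℕ) .{{_ : NonZero k}} where

  G : Set
  G = Fin k × Bool × Bool × Bool

  _≟G_ : DecidableEquality G
  _≟G_ = ≡-dec FinP._≟_ (≡-dec BoolP._≟_ (≡-dec BoolP._≟_ BoolP._≟_))

  addF : Fin k → Fin k → Fin k
  addF i j = (toℕ i ℕ.+ toℕ j) mod k

  negF : Fin k → Fin k
  negF i = (k ∸ toℕ i) mod k

  -- multiplication, using b a^j = a^{-j} b
  _·_ : G → G → G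
  (i , e , f , g) · (j , e' , f' , g') =
    (addF i (if e then negF j else j) , e xor e' , f xor f' , g xor g')

  infixl 7 _·_

  inv : G → G
  inv (i , true  , f , g) = (i , true , f , g)
  inv (i , false , f , g) = (negF i , false , f , g)

  one : G
  one = (0 mod k , false , false , false)

  a b c d : G
  a = (1 mod k , false , false , false)
  b = (0 mod k , true  , false , false)
  c = (0 mod k , false , true  , false)
  d = (0 mod k , false , false , true)

  pow : G → ℕ → G
  pow x zero    = one
  pow x (suc n) = x · pow x n

  A : List G
  A = map (λ j → pow a (toℕ j)) (allFin k)

  A-minus-ainv : List G
  A-minus-ainv = filter (λ x → Relation.Nullary.¬? (x ≟G inv a)) A

  S : List G
  S = map (b ·_) A-minus-ainv
      ++ map (c ·_) (A ++ (b ∷ []))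
      ++ (d · b ∷ d · c · b · inv a ∷ [])

  allG : List G
  allG = cartesianProduct (allFin k)
           (cartesianProduct bools (cartesianProduct bools bools))
    where
      bools : List Bool
      bools = false ∷ true ∷ []

  Cay : FinGraph
  Cay = record
    { V        = G
    ; vertices = allG
    ; _~_      = λ g h → h · inv g Mem.∈ S
    ; _~?_     = λ g h → ∈?-of _≟G_ (h · inv g) S
    }

module Submission where

-- Γ is a Cayley graph, so translating by x identifies the common neighbours of x and y with
-- S ∩ S h⁻¹ for h = x y⁻¹.  Writing elements as aⁱ bᵉ cᶠ dᵍ, S meets each of the eight cosets
-- of ⟨a⟩ in ∅, ⟨a⟩, a single point or ⟨a⟩ minus a point, and right multiplication by h = aʲ t′
-- maps the coset t to t t′ while translating the exponent i by ±j.  Hence |S ∩ S h⁻¹| is a sum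
-- of eight sizes of intersections of two such subsets of ℤ/k; it is 2(k − 1) for h ∈ ⟨a⟩ ∖ {1}
-- and for h ∈ ⟨a⟩bc, and 2 for every other h ≠ 1, while the same slicing gives the degree
-- |S| = 2(k + 1).  The neighbours c and cb of 1 realise both values, so Γ is not strongly
-- regular, and as distinct vertices always have a common neighbour, the diameter is 2.

open import Defs
open import Level using (0ℓ)
open import Algebra.Bundles using (AbelianGroup; Group)
open import Algebra.Structures using (IsAbelianGroup; IsGroup)
open import Algebra.Consequences.Propositional using (comm∧idˡ⇒id; comm∧invʳ⇒inv)
import Algebra.Properties.AbelianGroup as AbelianGroupProperties
import Algebra.Properties.Group as GroupProperties
open import Data.Bool using (Bool; true; false; _xor_; if_then_else_)
import Data.Bool.Properties as Bool
open import Data.Empty using (⊥; ⊥-elim)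
open import Data.Fin using (Fin; toℕ)
import Data.Fin.Properties as Fin
open import Data.List using (List; []; _∷_; _++_; map; filter; length; allFin; cartesianProduct)
import Data.List.Properties as List
open import Data.List.Membership.Propositional using (_∈_)
open import Data.List.Membership.Propositional.Properties
  using (∈-map⁺; ∈-map⁻; ∈-++⁺ˡ; ∈-++⁺ʳ; ∈-++⁻; ∈-filter⁺; ∈-filter⁻; ∈-allFin; ∈-cartesianProduct⁺)
open import Data.List.Membership.Propositional.Properties.WithK using (unique∧set⇒bag)
open import Data.List.Relation.Binary.BagAndSetEquality using (∼bag⇒↭)
open import Data.List.Relation.Binary.Permutation.Propositional.Properties using (filter-↭; ↭-length)
open import Data.List.Relation.Unary.All using (All; []; _∷_; universal)
import Data.List.Relation.Unary.All as All
open import Data.List.Relation.Unary.Any using (here; there)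
open import Data.List.Relation.Unary.Unique.Propositional using (Unique; []; _∷_)
import Data.List.Relation.Unary.Unique.Propositional.Properties as Unique
open import Data.Nat using (ℕ; zero; suc; NonZero; >-nonZero⁻¹; _≤_; _+_; _*_; _∸_; s≤s; z≤n)
open import Data.Nat.DivMod using (_mod_; _%_; m%n<n; m<n⇒m%n≡m; %-distribˡ-+; n%n≡0; m*n%n≡0)
open import Data.Nat.ListAction using (sum)
import Data.Nat.Properties as ℕ
open import Data.Nat.Tactic.RingSolver using (solve-∀)
open import Data.Product using (_×_; _,_; proj₁; proj₂; swap; Σ-syntax)
open import Data.Sum using (_⊎_; inj₁; inj₂)
open import Data.Unit using (⊤; tt)
open import Function.Base using (id; _∘_)
open import Function.Bundles using (_⇔_; mk⇔; Equivalence)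
import Function.Properties.Equivalence as ⇔
open import Relation.Binary using (DecidableEquality)
open import Relation.Binary.PropositionalEquality
open import Relation.Nullary using (¬_; Dec; yes; no; does; ¬?; _×-dec_; contradiction)
open import Relation.Unary using (Pred; Decidable; ∁; _≐_)
open import Relation.Unary.Properties using (∁?; _∩?_)

indicator : {P : Set} → Dec P → ℕ
indicator (yes _) = 1
indicator (no _) = 0

count : {A : Set} {P : Pred A 0ℓ} → Decidable P → List A → ℕ
count P? xs = length (filter P? xs)

module _ {A : Set} {P : Pred A 0ℓ} (P? : Decidable P) where

  count-≐ : {Q : Pred A 0ℓ} (Q? : Decidable Q) → P ≐ Q → ∀ xs → count P? xs ≡ count Q? xs
  count-≐ Q? P≐Q xs = cong length (List.filter-≐ P? Q? P≐Q xs)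

  count-none : ∀ {xs} → All (∁ P) xs → count P? xs ≡ 0
  count-none ¬ps = cong length (List.filter-none P? ¬ps)

  count-all : ∀ {xs} → All P xs → count P? xs ≡ length xs
  count-all ps = cong length (List.filter-all P? ps)

  count-∷ : ∀ x xs → count P? (x ∷ xs) ≡ indicator (P? x) + count P? xs
  count-∷ x xs with P? x
  ... | yes _ = refl
  ... | no _ = refl

  count-++ : ∀ xs ys → count P? (xs ++ ys) ≡ count P? xs + count P? ys
  count-++ xs ys = trans (cong length (List.filter-++ P? xs ys)) (List.length-++ (filter P? xs))

  count-map : {B : Set} (f : B → A) → ∀ xs → count P? (map f xs) ≡ count (λ x → P? (f x)) xs
  count-map f [] = refl
  count-map f (x ∷ xs) with P? (f x)
  ... | yes _ = cong suc (count-map f xs)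
  ... | no _ = count-map f xs

  count-∁ : ∀ xs → count P? xs + count (∁? P?) xs ≡ length xs
  count-∁ [] = refl
  count-∁ (x ∷ xs) with P? x
  ... | yes _ = cong suc (count-∁ xs)
  ... | no _ = trans (ℕ.+-suc _ _) (cong suc (count-∁ xs))

  count-∩∁ : {Q : Pred A 0ℓ} (Q? : Decidable Q) → ∀ xs →
             count (P? ∩? Q?) xs + count (P? ∩? ∁? Q?) xs ≡ count P? xs
  count-∩∁ Q? [] = refl
  count-∩∁ Q? (x ∷ xs) with P? x | Q? x
  ... | yes _ | yes _ = cong suc (count-∩∁ Q? xs)
  ... | yes _ | no _ = trans (ℕ.+-suc _ _) (cong suc (count-∩∁ Q? xs))
  ... | no _ | yes _ = count-∩∁ Q? xs
  ... | no _ | no _ = count-∩∁ Q? xs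

  count≡sum-indicator : ∀ xs → count P? xs ≡ sum (map (λ x → indicator (P? x)) xs)
  count≡sum-indicator [] = refl
  count≡sum-indicator (x ∷ xs) = trans (count-∷ x xs) (cong (indicator (P? x) +_) (count≡sum-indicator xs))

  count-cong-unique : ∀ {xs ys} → Unique xs → Unique ys →
                      (∀ {x} → x ∈ xs → x ∈ ys) → (∀ {x} → x ∈ ys → x ∈ xs) →
                      count P? xs ≡ count P? ys
  count-cong-unique xs! ys! xs⊆ys ys⊆xs =
    ↭-length (filter-↭ P? (∼bag⇒↭ (unique∧set⇒bag xs! ys! (mk⇔ xs⊆ys ys⊆xs))))

  count≢0⇒∃ : ∀ xs → count P? xs ≢ 0 → Σ[ x ∈ A ] P x
  count≢0⇒∃ [] count≢0 = ⊥-elim (count≢0 refl)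
  count≢0⇒∃ (x ∷ xs) count≢0 with P? x
  ... | yes px = x , px
  ... | no _ = count≢0⇒∃ xs count≢0

count-≡-unique : {A : Set} (_≟_ : DecidableEquality A) {c : A} {xs : List A} →
                 Unique xs → c ∈ xs → count (_≟ c) xs ≡ 1
count-≡-unique _≟_ {c} {x ∷ xs} (x∉xs ∷ xs!) c∈ with x ≟ c | c∈
... | yes refl | _ = cong suc (count-none (_≟ c) (All.map ≢-sym x∉xs))
... | no x≢c | here c≡x = ⊥-elim (x≢c (sym c≡x))
... | no _ | there c∈xs = count-≡-unique _≟_ xs! c∈xs

length-cartesianProduct : {A B : Set} (xs : List A) (ys : List B) →
                          length (cartesianProduct xs ys) ≡ length xs * length ys
length-cartesianProduct [] ys = refl
length-cartesianProduct (x ∷ xs) ys = trans (List.length-++ (map (x ,_) ys))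
  (cong₂ _+_ (List.length-map (x ,_) ys) (length-cartesianProduct xs ys))

sum-map-cong : {A : Set} {f g : A → ℕ} → (∀ x → f x ≡ g x) → ∀ xs → sum (map f xs) ≡ sum (map g xs)
sum-map-cong f≗g xs = cong sum (List.map-cong f≗g xs)

sum-map-+ : {A : Set} (f g : A → ℕ) → ∀ xs →
            sum (map (λ x → f x + g x) xs) ≡ sum (map f xs) + sum (map g xs)
sum-map-+ f g [] = refl
sum-map-+ f g (x ∷ xs) = trans (cong (f x + g x +_) (sum-map-+ f g xs)) (interchange (f x) (g x) _ _)
  where open import Algebra.Properties.CommutativeSemigroup ℕ.+-commutativeSemigroup using (interchange)

sum-map-zero : {A : Set} → ∀ (xs : List A) → sum (map (λ _ → 0) xs) ≡ 0
sum-map-zero [] = refl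
sum-map-zero (x ∷ xs) = sum-map-zero xs

count-cartesianProduct : {A B : Set} {P : Pred (A × B) 0ℓ} (P? : Decidable P) → ∀ xs ys →
                         count P? (cartesianProduct xs ys) ≡ sum (map (λ y → count (λ x → P? (x , y)) xs) ys)
count-cartesianProduct P? [] ys = sym (sum-map-zero ys)
count-cartesianProduct P? (x ∷ xs) ys = begin
  count P? (map (x ,_) ys ++ cartesianProduct xs ys)
    ≡⟨ count-++ P? (map (x ,_) ys) _ ⟩
  count P? (map (x ,_) ys) + count P? (cartesianProduct xs ys)
    ≡⟨ cong₂ _+_ (trans (count-map P? (x ,_) ys) (count≡sum-indicator _ ys))
                 (count-cartesianProduct P? xs ys) ⟩
  sum (map (λ y → indicator (P? (x , y))) ys) + sum (map (λ y → count (λ x → P? (x , y)) xs) ys)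
    ≡⟨ sum-map-+ _ _ ys ⟨
  sum (map (λ y → indicator (P? (x , y)) + count (λ x → P? (x , y)) xs) ys)
    ≡⟨ sum-map-cong (λ y → count-∷ (λ x → P? (x , y)) x xs) ys ⟨
  sum (map (λ y → count (λ x → P? (x , y)) (x ∷ xs)) ys) ∎
  where open ≡-Reasoning

data Cond (A : Set) : Set where
  always never : Cond A
  only allBut : A → Cond A

_⊨_ : {A : Set} → A → Cond A → Set
x ⊨ always = ⊤
x ⊨ never = ⊥
x ⊨ only c = x ≡ c
x ⊨ allBut c = x ≢ c

module CondCount {A : Set} (_≟_ : DecidableEquality A) (xs : List A) (n : ℕ)
                 (xs! : Unique xs) (∈xs : ∀ x → x ∈ xs) (|xs| : length xs ≡ n) where

  _⊨?_ : ∀ x C → Dec (x ⊨ C)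
  x ⊨? always = yes tt
  x ⊨? never = no λ ()
  x ⊨? only c = x ≟ c
  x ⊨? allBut c = ¬? (x ≟ c)

  bothSize : Cond A → Cond A → ℕ
  bothSize never D = 0
  bothSize (only c) D = indicator (c ⊨? D)
  bothSize always never = 0
  bothSize always (only d) = 1
  bothSize always always = n
  bothSize always (allBut d) = n ∸ 1
  bothSize (allBut c) never = 0
  bothSize (allBut c) (only d) = indicator (d ⊨? allBut c)
  bothSize (allBut c) always = n ∸ 1
  bothSize (allBut c) (allBut d) = if does (c ≟ d) then n ∸ 1 else n ∸ 2

  countBoth : Cond A → Cond A → ℕ
  countBoth C D = count (λ x → (x ⊨? C) ×-dec (x ⊨? D)) xs

  countBoth-comm : ∀ C D → countBoth C D ≡ countBoth D C
  countBoth-comm C D = count-≐ _ _ (swap , swap) xs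

  count-≡ : ∀ c → count (_≟ c) xs ≡ 1
  count-≡ c = count-≡-unique _≟_ xs! (∈xs c)

  count-≢ : ∀ c → count (λ x → ¬? (x ≟ c)) xs ≡ n ∸ 1
  count-≢ c = begin
    others                        ≡⟨ ℕ.m+n∸m≡n 1 others ⟨
    1 + others ∸ 1                ≡⟨ cong (λ m → m + others ∸ 1) (count-≡ c) ⟨
    count (_≟ c) xs + others ∸ 1  ≡⟨ cong (_∸ 1) (trans (count-∁ (_≟ c) xs) |xs|) ⟩
    n ∸ 1                         ∎
    where
    open ≡-Reasoning
    others = count (λ x → ¬? (x ≟ c)) xs

  countBoth-allBut-≢ : ∀ {c d} → c ≢ d → countBoth (allBut c) (allBut d) ≡ n ∸ 2
  countBoth-allBut-≢ {c} {d} c≢d = begin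
    neither                                      ≡⟨ ℕ.m+n∸m≡n 1 neither ⟨
    1 + neither ∸ 1                              ≡⟨ cong (λ m → m + neither ∸ 1) only-c ⟨
    countBoth (allBut d) (only c) + neither ∸ 1  ≡⟨ cong (λ m → countBoth (allBut d) (only c) + m ∸ 1)
                                                         (countBoth-comm (allBut c) (allBut d)) ⟩
    countBoth (allBut d) (only c) + countBoth (allBut d) (allBut c) ∸ 1
                                                 ≡⟨ cong (_∸ 1) (count-∩∁ (_⊨? allBut d) (_≟ c) xs) ⟩
    count (λ x → ¬? (x ≟ d)) xs ∸ 1              ≡⟨ cong (_∸ 1) (count-≢ d) ⟩
    n ∸ 1 ∸ 1                                    ≡⟨ ℕ.∸-+-assoc n 1 1 ⟩
    n ∸ 2                                        ∎
    where
    open ≡-Reasoning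
    neither = countBoth (allBut c) (allBut d)
    only-c : countBoth (allBut d) (only c) ≡ 1
    only-c = trans (count-≐ _ (_≟ c) (proj₂ , λ { refl → c≢d , refl }) xs) (count-≡ c)

  countBoth≡bothSize : ∀ C D → countBoth C D ≡ bothSize C D
  countBoth≡bothSize never D = count-none _ (universal (λ _ ()) xs)
  countBoth≡bothSize (only c) D with c ⊨? D
  ... | yes c⊨D = trans (count-≐ _ (_≟ c) (proj₁ , λ { refl → refl , c⊨D }) xs) (count-≡ c)
  ... | no c⊭D = count-none _ (universal (λ { _ (refl , c⊨D) → c⊭D c⊨D }) xs)
  countBoth≡bothSize always never = count-none _ (universal (λ _ ()) xs)
  countBoth≡bothSize always (only d) =
    trans (countBoth-comm always (only d)) (countBoth≡bothSize (only d) always)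
  countBoth≡bothSize always always = trans (count-all _ (universal _ xs)) |xs|
  countBoth≡bothSize always (allBut d) = trans (count-≐ _ _ (proj₂ , (tt ,_)) xs) (count-≢ d)
  countBoth≡bothSize (allBut c) never = count-none _ (universal (λ _ ()) xs)
  countBoth≡bothSize (allBut c) (only d) =
    trans (countBoth-comm (allBut c) (only d)) (countBoth≡bothSize (only d) (allBut c))
  countBoth≡bothSize (allBut c) always = trans (count-≐ _ _ (proj₁ , (_, tt)) xs) (count-≢ c)
  countBoth≡bothSize (allBut c) (allBut d) with c ≟ d
  ... | yes refl = trans (count-≐ _ _ (proj₁ , λ c≢x → c≢x , c≢x) xs) (count-≢ c)
  ... | no c≢d = countBoth-allBut-≢ c≢d

  bothSize-only-comm : ∀ c d → bothSize (only c) (only d) ≡ bothSize (only d) (only c)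
  bothSize-only-comm c d = trans (sym (countBoth≡bothSize (only c) (only d)))
    (trans (countBoth-comm (only c) (only d)) (countBoth≡bothSize (only d) (only c)))

  bothSize-only-split : ∀ c d → bothSize (only c) (only d) + bothSize (only c) (allBut d) ≡ 1
  bothSize-only-split c d with c ≟ d
  ... | yes _ = refl
  ... | no _ = refl

  bothSize-only-≢ : ∀ {c d} → c ≢ d → bothSize (only c) (only d) ≡ 0
  bothSize-only-≢ {c} {d} c≢d with c ≟ d
  ... | yes c≡d = ⊥-elim (c≢d c≡d)
  ... | no _ = refl

  bothSize-allBut-≢ : ∀ {c d} → c ≢ d → bothSize (allBut c) (allBut d) ≡ n ∸ 2
  bothSize-allBut-≢ {c} {d} c≢d with c ≟ d
  ... | yes c≡d = ⊥-elim (c≢d c≡d)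
  ... | no _ = refl

  bothSize-only-cong : ∀ {c d c′ d′} → c ≡ d ⇔ c′ ≡ d′ →
                       bothSize (only c) (only d) ≡ bothSize (only c′) (only d′)
  bothSize-only-cong {c} {d} {c′} {d′} c≡d⇔c′≡d′ with c ≟ d | c′ ≟ d′
  ... | yes _ | yes _ = refl
  ... | no _ | no _ = refl
  ... | yes c≡d | no c′≢d′ = ⊥-elim (c′≢d′ (Equivalence.to c≡d⇔c′≡d′ c≡d))
  ... | no c≢d | yes c′≡d′ = ⊥-elim (c≢d (Equivalence.from c≡d⇔c′≡d′ c′≡d′))

n+[n∸1+3]≡2[n+1] : ∀ n .{{_ : NonZero n}} → n + (n ∸ 1 + 3) ≡ 2 * (n + 1)
n+[n∸1+3]≡2[n+1] (suc m) = identity m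
  where
  identity : ∀ m → suc m + (m + 3) ≡ 2 * (suc m + 1)
  identity = solve-∀

n+[n∸2+0]≡2[n∸1] : ∀ {n} → 2 ≤ n → n + (n ∸ 2 + 0) ≡ 2 * (n ∸ 1)
n+[n∸2+0]≡2[n∸1] {suc (suc m)} (s≤s (s≤s z≤n)) = cong suc (sym (ℕ.+-suc m (m + 0)))

2[n∸1]≢0 : ∀ {n} → 2 ≤ n → 2 * (n ∸ 1) ≢ 0
2[n∸1]≢0 {suc (suc m)} (s≤s (s≤s z≤n)) ()

2≢2[n∸1] : ∀ {n} → 3 ≤ n → 2 ≢ 2 * (n ∸ 1)
2≢2[n∸1] 3≤n 2≡2[n∸1] =
  contradiction (subst (4 ≤_) (sym 2≡2[n∸1]) (ℕ.*-monoʳ-≤ 2 (ℕ.∸-monoˡ-≤ 1 3≤n))) λ { (s≤s (s≤s ())) }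

module _ (k : ℕ) .{{_ : NonZero k}} where
  open Construction k

  toℕ-mod : ∀ n → toℕ (n mod k) ≡ n % k
  toℕ-mod n = Fin.toℕ-fromℕ< (m%n<n n k)

  %-≡⇒mod-≡ : ∀ {m n} → m % k ≡ n % k → m mod k ≡ n mod k
  %-≡⇒mod-≡ {m} {n} eq = Fin.toℕ-injective (trans (toℕ-mod m) (trans eq (sym (toℕ-mod n))))

  mod-toℕ : ∀ i → toℕ i mod k ≡ i
  mod-toℕ i = Fin.toℕ-injective (trans (toℕ-mod (toℕ i)) (m<n⇒m%n≡m (Fin.toℕ<n i)))

  addF-mod : ∀ m n → addF (m mod k) (n mod k) ≡ (m + n) mod k
  addF-mod m n = %-≡⇒mod-≡ (trans (cong₂ (λ u v → (u + v) % k) (toℕ-mod m) (toℕ-mod n))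
                                  (sym (%-distribˡ-+ m n k)))

  addF-comm : ∀ i j → addF i j ≡ addF j i
  addF-comm i j = cong (_mod k) (ℕ.+-comm (toℕ i) (toℕ j))

  addF-assoc : ∀ i j l → addF (addF i j) l ≡ addF i (addF j l)
  addF-assoc i j l = begin
    addF (addF i j) l                          ≡⟨ cong (addF (addF i j)) (mod-toℕ l) ⟨
    addF ((m + n) mod k) (o mod k)             ≡⟨ addF-mod (m + n) o ⟩
    (m + n + o) mod k                          ≡⟨ cong (_mod k) (ℕ.+-assoc m n o) ⟩
    (m + (n + o)) mod k                        ≡⟨ addF-mod m (n + o) ⟨
    addF (m mod k) ((n + o) mod k)             ≡⟨ cong (λ i′ → addF i′ (addF j l)) (mod-toℕ i) ⟩
    addF i (addF j l)                          ∎
    where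
    open ≡-Reasoning
    m = toℕ i
    n = toℕ j
    o = toℕ l

  addF-identityˡ : ∀ i → addF (0 mod k) i ≡ i
  addF-identityˡ i = begin
    addF (0 mod k) i                ≡⟨ cong (addF (0 mod k)) (mod-toℕ i) ⟨
    addF (0 mod k) (toℕ i mod k)    ≡⟨ addF-mod 0 (toℕ i) ⟩
    toℕ i mod k                     ≡⟨ mod-toℕ i ⟩
    i                               ∎
    where open ≡-Reasoning

  addF-inverseʳ : ∀ i → addF i (negF i) ≡ 0 mod k
  addF-inverseʳ i = begin
    addF i (negF i)                         ≡⟨ cong (λ i′ → addF i′ (negF i)) (mod-toℕ i) ⟨
    addF (toℕ i mod k) ((k ∸ toℕ i) mod k)  ≡⟨ addF-mod (toℕ i) (k ∸ toℕ i) ⟩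
    (toℕ i + (k ∸ toℕ i)) mod k             ≡⟨ cong (_mod k) (ℕ.m+[n∸m]≡n (ℕ.<⇒≤ (Fin.toℕ<n i))) ⟩
    k mod k                                 ≡⟨ %-≡⇒mod-≡ (trans (n%n≡0 k) (sym (m*n%n≡0 0 k))) ⟩
    0 mod k                                 ∎
    where open ≡-Reasoning

  ℤₖ-isAbelianGroup : IsAbelianGroup _≡_ addF (0 mod k) negF
  ℤₖ-isAbelianGroup = record
    { isGroup = record
      { isMonoid = record
        { isSemigroup = record
          { isMagma = record { isEquivalence = isEquivalence ; ∙-cong = cong₂ addF }
          ; assoc = addF-assoc }
        ; identity = comm∧idˡ⇒id addF-comm addF-identityˡ }
      ; inverse = comm∧invʳ⇒inv addF-comm addF-inverseʳ
      ; ⁻¹-cong = cong negF }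
    ; comm = addF-comm }

  ℤₖ : AbelianGroup 0ℓ 0ℓ
  ℤₖ = record { isAbelianGroup = ℤₖ-isAbelianGroup }

  private module ℤₖ where
    open AbelianGroup ℤₖ public
    open AbelianGroupProperties ℤₖ public

  twist : Bool → Fin k → Fin k
  twist e j = if e then negF j else j

  twist-homo : ∀ e i j → twist e (addF i j) ≡ addF (twist e i) (twist e j)
  twist-homo true i j = sym (ℤₖ.⁻¹-∙-comm i j)
  twist-homo false i j = refl

  twist-xor : ∀ e e′ i → twist (e xor e′) i ≡ twist e (twist e′ i)
  twist-xor true true i = sym (ℤₖ.⁻¹-involutive i)
  twist-xor true false i = refl
  twist-xor false e′ i = refl

  twist-zero : ∀ e → twist e (0 mod k) ≡ 0 mod k
  twist-zero true = ℤₖ.ε⁻¹≈ε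
  twist-zero false = refl

  ·-assoc : ∀ u v w → (u · v) · w ≡ u · (v · w)
  ·-assoc (i , e , f , g) (j , e′ , f′ , g′) (l , e″ , f″ , g″) =
    cong₂ _,_ index (cong₂ _,_ (Bool.xor-assoc e e′ e″)
                      (cong₂ _,_ (Bool.xor-assoc f f′ f″) (Bool.xor-assoc g g′ g″)))
    where
    open ≡-Reasoning
    index : addF (addF i (twist e j)) (twist (e xor e′) l) ≡ addF i (twist e (addF j (twist e′ l)))
    index = begin
      addF (addF i (twist e j)) (twist (e xor e′) l)     ≡⟨ addF-assoc i _ _ ⟩
      addF i (addF (twist e j) (twist (e xor e′) l))     ≡⟨ cong (addF i ∘ addF (twist e j)) (twist-xor e e′ l) ⟩
      addF i (addF (twist e j) (twist e (twist e′ l)))   ≡⟨ cong (addF i) (twist-homo e j _) ⟨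
      addF i (twist e (addF j (twist e′ l)))             ∎

  ·-identityˡ : ∀ u → one · u ≡ u
  ·-identityˡ (i , t) = cong (_, t) (addF-identityˡ i)

  ·-identityʳ : ∀ u → u · one ≡ u
  ·-identityʳ (i , e , f , g) =
    cong₂ _,_ (trans (cong (addF i) (twist-zero e)) (ℤₖ.identityʳ i))
      (cong₂ _,_ (Bool.xor-identityʳ e) (cong₂ _,_ (Bool.xor-identityʳ f) (Bool.xor-identityʳ g)))

  ·-inverseˡ : ∀ u → inv u · u ≡ one
  ·-inverseˡ (i , true , f , g) =
    cong₂ _,_ (ℤₖ.inverseʳ i) (cong₂ _,_ refl (cong₂ _,_ (Bool.xor-same f) (Bool.xor-same g)))
  ·-inverseˡ (i , false , f , g) =
    cong₂ _,_ (ℤₖ.inverseˡ i) (cong₂ _,_ refl (cong₂ _,_ (Bool.xor-same f) (Bool.xor-same g)))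

  ·-inverseʳ : ∀ u → u · inv u ≡ one
  ·-inverseʳ (i , true , f , g) = ·-inverseˡ (i , true , f , g)
  ·-inverseʳ (i , false , f , g) =
    cong₂ _,_ (ℤₖ.inverseʳ i) (cong₂ _,_ refl (cong₂ _,_ (Bool.xor-same f) (Bool.xor-same g)))

  G-isGroup : IsGroup _≡_ _·_ one inv
  G-isGroup = record
    { isMonoid = record
      { isSemigroup = record
        { isMagma = record { isEquivalence = isEquivalence ; ∙-cong = cong₂ _·_ }
        ; assoc = ·-assoc }
      ; identity = ·-identityˡ , ·-identityʳ }
    ; inverse = ·-inverseˡ , ·-inverseʳ
    ; ⁻¹-cong = cong inv }

  G-group : Group 0ℓ 0ℓ
  G-group = record { isGroup = G-isGroup }

  private module G where
    open Group G-group public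
    open GroupProperties G-group public

  𝟘 𝟙 : Fin k
  𝟘 = 0 mod k
  𝟙 = 1 mod k

  aPower : Fin k → G
  aPower j = (j , false , false , false)

  pow-a : ∀ n → pow a n ≡ aPower (n mod k)
  pow-a zero = refl
  pow-a (suc n) = trans (cong (a ·_) (pow-a n)) (cong aPower (addF-mod 1 n))

  aPower∈A : ∀ j → aPower j ∈ A
  aPower∈A j = subst (_∈ A) (trans (pow-a (toℕ j)) (cong aPower (mod-toℕ j)))
                 (∈-map⁺ (λ j → pow a (toℕ j)) (∈-allFin j))

  ∈A⇒aPower : ∀ {x} → x ∈ A → Σ[ j ∈ Fin k ] x ≡ aPower j
  ∈A⇒aPower x∈A with ∈-map⁻ (λ j → pow a (toℕ j)) x∈A
  ... | j , _ , refl = j , trans (pow-a (toℕ j)) (cong aPower (mod-toℕ j))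

  Coset : Set
  Coset = Bool × Bool × Bool

  -- b aʲ = a⁻ʲ b, so b(A ∖ {a⁻¹}) is the slice i ≢ 1 of the coset ⟨a⟩b; cA, cb, db and
  -- d c b a⁻¹ = a b c d give the other nonempty slices.
  S-slice : Coset → Cond (Fin k)
  S-slice (true  , false , false) = allBut 𝟙
  S-slice (false , true  , false) = always
  S-slice (true  , true  , false) = only 𝟘
  S-slice (true  , false , true ) = only 𝟘
  S-slice (true  , true  , true ) = only 𝟙
  S-slice (false , false , false) = never
  S-slice (false , false , true ) = never
  S-slice (false , true  , true ) = never

  InS : G → Set
  InS (i , t) = i ⊨ S-slice t

  length-allFin : length (allFin k) ≡ k
  length-allFin = List.length-tabulate id

  open CondCount Fin._≟_ (allFin k) k (Unique.allFin⁺ k) ∈-allFin length-allFin public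

  private
    bPart cPart : List G
    bPart = map (b ·_) A-minus-ainv
    cPart = map (c ·_) (A ++ b ∷ [])

  dcba⁻¹≡a¹bcd : d · c · b · inv a ≡ (𝟙 , true , true , true)
  dcba⁻¹≡a¹bcd = cong (_, true , true , true)
    (trans (cong₂ addF (trans (ℤₖ.identityʳ _) (addF-identityˡ 𝟘)) (ℤₖ.⁻¹-involutive 𝟙)) (addF-identityˡ 𝟙))

  ∈S⇒InS : ∀ {w} → w ∈ S → InS w
  ∈S⇒InS w∈S with ∈-++⁻ bPart w∈S
  ... | inj₁ w∈bA with ∈-map⁻ (b ·_) w∈bA
  ...   | x , x∈ , refl with ∈-filter⁻ (λ x → ¬? (x ≟G inv a)) x∈
  ...     | x∈A , x≢a⁻¹ with ∈A⇒aPower x∈A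
  ...       | j , refl = λ −j≡1 → x≢a⁻¹ (cong aPower
                 (trans (sym (ℤₖ.⁻¹-involutive j)) (cong negF (trans (sym (addF-identityˡ _)) −j≡1))))
  ∈S⇒InS w∈S | inj₂ w∈cA∪ with ∈-++⁻ cPart w∈cA∪
  ... | inj₁ w∈cA with ∈-map⁻ (c ·_) w∈cA
  ...   | x , x∈ , refl with ∈-++⁻ A x∈
  ...     | inj₁ x∈A with ∈A⇒aPower x∈A
  ...       | j , refl = tt
  ∈S⇒InS w∈S | inj₂ _ | inj₁ _ | x , _ , refl | inj₂ (here refl) = addF-identityˡ 𝟘
  ∈S⇒InS w∈S | inj₂ _ | inj₂ (here refl) = addF-identityˡ 𝟘
  ∈S⇒InS w∈S | inj₂ _ | inj₂ (there (here refl)) = cong proj₁ dcba⁻¹≡a¹bcd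

  InS⇒∈S : ∀ w → InS w → w ∈ S
  InS⇒∈S (i , true , false , false) i≢1 =
    subst (_∈ S) (cong (_, true , false , false) (trans (addF-identityˡ _) (ℤₖ.⁻¹-involutive i)))
      (∈-++⁺ˡ (∈-map⁺ (b ·_) (∈-filter⁺ (λ x → ¬? (x ≟G inv a)) (aPower∈A (negF i))
        λ −i≡−1 → i≢1 (ℤₖ.⁻¹-injective (cong proj₁ −i≡−1)))))
  InS⇒∈S (i , false , true , false) _ =
    subst (_∈ S) (cong (_, false , true , false) (addF-identityˡ i))
      (∈-++⁺ʳ bPart (∈-++⁺ˡ (∈-map⁺ (c ·_) (∈-++⁺ˡ (aPower∈A i)))))
  InS⇒∈S (i , true , true , false) refl =
    subst (_∈ S) (cong (_, true , true , false) (addF-identityˡ 𝟘))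
      (∈-++⁺ʳ bPart (∈-++⁺ˡ (∈-map⁺ (c ·_) (∈-++⁺ʳ A (here refl)))))
  InS⇒∈S (i , true , false , true) refl =
    subst (_∈ S) (cong (_, true , false , true) (addF-identityˡ 𝟘))
      (∈-++⁺ʳ bPart (∈-++⁺ʳ cPart (here refl)))
  InS⇒∈S (i , true , true , true) refl =
    subst (_∈ S) dcba⁻¹≡a¹bcd (∈-++⁺ʳ bPart (∈-++⁺ʳ cPart (there (here refl))))
  InS⇒∈S (i , false , false , false) ()
  InS⇒∈S (i , false , false , true) ()
  InS⇒∈S (i , false , true , true) ()

  bools : List Bool
  bools = false ∷ true ∷ []

  cosets : List Coset
  cosets = cartesianProduct bools (cartesianProduct bools bools)

  _⊕_ : Coset → Coset → Coset
  (e , f , g) ⊕ (e′ , f′ , g′) = (e xor e′ , f xor f′ , g xor g′)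

  allG-unique : Unique allG
  allG-unique = Unique.cartesianProduct⁺ (Unique.allFin⁺ k)
    (Unique.cartesianProduct⁺ bools! (Unique.cartesianProduct⁺ bools! bools!))
    where
    bools! : Unique bools
    bools! = ((λ ()) ∷ []) ∷ [] ∷ []

  ∈allG : ∀ z → z ∈ allG
  ∈allG (i , e , f , g) = ∈-cartesianProduct⁺ (∈-allFin i)
    (∈-cartesianProduct⁺ (∈bools e) (∈-cartesianProduct⁺ (∈bools f) (∈bools g)))
    where
    ∈bools : ∀ e → e ∈ bools
    ∈bools false = here refl
    ∈bools true = there (here refl)

  count-·ʳ : {P : Pred G 0ℓ} (P? : Decidable P) → ∀ g → count P? allG ≡ count (λ z → P? (z · g)) allG
  count-·ʳ P? g = trans
    (count-cong-unique P? allG-unique (Unique.map⁺ (G.∙-cancelʳ g _ _) allG-unique)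
      (λ {z} _ → subst (_∈ map (_· g) allG) (G.//-rightDividesˡ g z) (∈-map⁺ (_· g) (∈allG (z · inv g))))
      (λ {z} _ → ∈allG z))
    (count-map P? (_· g) allG)

  count-slices : (C D : Coset → Cond (Fin k)) →
                 count (λ { (i , t) → (i ⊨? C t) ×-dec (i ⊨? D t) }) allG
                   ≡ sum (map (λ t → bothSize (C t) (D t)) cosets)
  count-slices C D = trans (count-cartesianProduct _ (allFin k) cosets)
    (sum-map-cong (λ t → countBoth≡bothSize (C t) (D t)) cosets)

  shift : Cond (Fin k) → Fin k → Cond (Fin k)
  shift always s = always
  shift never s = never
  shift (only c) s = only (c ℤₖ.- s)
  shift (allBut c) s = allBut (c ℤₖ.- s)

  i+s≡c⇒i≡c-s : ∀ {i s c} → addF i s ≡ c → i ≡ c ℤₖ.- s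
  i+s≡c⇒i≡c-s {i} {s} i+s≡c = trans (sym (ℤₖ.//-rightDividesʳ s i)) (cong (ℤₖ._- s) i+s≡c)

  i≡c-s⇒i+s≡c : ∀ {i s c} → i ≡ c ℤₖ.- s → addF i s ≡ c
  i≡c-s⇒i+s≡c {s = s} {c} refl = ℤₖ.//-rightDividesˡ s c

  ⊨-shift : ∀ C i s → addF i s ⊨ C ⇔ i ⊨ shift C s
  ⊨-shift always i s = mk⇔ _ _
  ⊨-shift never i s = mk⇔ (λ ()) (λ ())
  ⊨-shift (only c) i s = mk⇔ i+s≡c⇒i≡c-s i≡c-s⇒i+s≡c
  ⊨-shift (allBut c) i s =
    mk⇔ (λ i+s≢c → i+s≢c ∘ i≡c-s⇒i+s≡c) (λ i≢c-s → i≢c-s ∘ i+s≡c⇒i≡c-s)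

  c≡c-s⇔s≡0 : ∀ c s → c ≡ c ℤₖ.- s ⇔ s ≡ 𝟘
  c≡c-s⇔s≡0 c s = mk⇔
    (λ c≡c-s → ℤₖ.⁻¹-injective
      (trans (sym (ℤₖ.∙-cancelˡ c 𝟘 (negF s) (trans (ℤₖ.identityʳ c) c≡c-s))) (sym ℤₖ.ε⁻¹≈ε)))
    (λ { refl → sym (trans (cong (addF c) ℤₖ.ε⁻¹≈ε) (ℤₖ.identityʳ c)) })

  open FinGraph Cay using (_~_; _~?_)

  ~·⇔InS : ∀ x y z → y ~ (z · x) ⇔ InS (z · (x · inv y))
  ~·⇔InS x y z = mk⇔ (λ adj → subst InS (·-assoc z x (inv y)) (∈S⇒InS adj))
                     (λ inS → InS⇒∈S _ (subst InS (sym (·-assoc z x (inv y))) inS))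

  ~·self⇔InS : ∀ x z → x ~ (z · x) ⇔ InS z
  ~·self⇔InS x z = mk⇔ (λ adj → subst InS (G.//-rightDividesʳ x z) (∈S⇒InS adj))
                       (λ inS → InS⇒∈S _ (subst InS (sym (G.//-rightDividesʳ x z)) inS))

  commonCount : G → ℕ
  commonCount (j , t′) =
    sum (map (λ t → bothSize (S-slice t) (shift (S-slice (t ⊕ t′)) (twist (proj₁ t) j))) cosets)

  commonNbrs≡commonCount : ∀ x y → commonNbrs Cay x y ≡ commonCount (x · inv y)
  commonNbrs≡commonCount x y = begin
    count (λ z → (x ~? z) ×-dec (y ~? z)) allG              ≡⟨ count-·ʳ _ x ⟩
    count (λ z → (x ~? (z · x)) ×-dec (y ~? (z · x))) allG  ≡⟨ count-≐ _ common? (to , from) allG ⟩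
    count common? allG                                      ≡⟨ count-slices S-slice shifted ⟩
    commonCount h                                           ∎
    where
    open ≡-Reasoning
    h = x · inv y
    shifted : Coset → Cond (Fin k)
    shifted t = shift (S-slice (t ⊕ proj₂ h)) (twist (proj₁ t) (proj₁ h))
    Common : G → Set
    Common (i , t) = i ⊨ S-slice t × i ⊨ shifted t
    common? : Decidable Common
    common? (i , t) = (i ⊨? S-slice t) ×-dec (i ⊨? shifted t)
    shift-h : ∀ i t → InS ((i , t) · h) ⇔ i ⊨ shifted t
    shift-h i t = ⊨-shift (S-slice (t ⊕ proj₂ h)) i (twist (proj₁ t) (proj₁ h))
    to : ∀ {z} → x ~ (z · x) × y ~ (z · x) → Common z
    to {i , t} (x~ , y~) = Equivalence.to (~·self⇔InS x (i , t)) x~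
                         , Equivalence.to (shift-h i t) (Equivalence.to (~·⇔InS x y (i , t)) y~)
    from : ∀ {z} → Common z → x ~ (z · x) × y ~ (z · x)
    from {i , t} (inS , inS·h) = Equivalence.from (~·self⇔InS x (i , t)) inS
                               , Equivalence.from (~·⇔InS x y (i , t)) (Equivalence.from (shift-h i t) inS·h)

  -- Here h = aʲ t′ with t′ ∈ {1, d, c, cd}, and [P] is the slice count that is 1 if P holds, else 0.
  module _ (j : Fin k) where
    private
      s p q : Fin k
      s = negF j
      p = 𝟘 ℤₖ.- s
      q = 𝟙 ℤₖ.- s

      [p≢1] [1≡p] [0≡q] [0≢q] [q≢1] [0≡p] [1≢q] [1≡q] : ℕ
      [p≢1] = bothSize (only p) (allBut 𝟙)
      [1≡p] = bothSize (only 𝟙) (only p)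
      [0≡q] = bothSize (only 𝟘) (only q)
      [0≢q] = bothSize (only 𝟘) (allBut q)
      [q≢1] = bothSize (only q) (allBut 𝟙)
      [0≡p] = bothSize (only 𝟘) (only p)
      [1≢q] = bothSize (only 𝟙) (allBut q)
      [1≡q] = bothSize (only 𝟙) (only q)

      [0≡p]≡[1≡q] : [0≡p] ≡ [1≡q]
      [0≡p]≡[1≡q] = bothSize-only-cong (⇔.trans (c≡c-s⇔s≡0 𝟘 s) (⇔.sym (c≡c-s⇔s≡0 𝟙 s)))

      [1≡p]+[p≢1] : [1≡p] + [p≢1] ≡ 1
      [1≡p]+[p≢1] = trans (cong (_+ [p≢1]) (bothSize-only-comm 𝟙 p)) (bothSize-only-split p 𝟙)

      [0≡q]+[0≢q] : [0≡q] + [0≢q] ≡ 1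
      [0≡q]+[0≢q] = bothSize-only-split 𝟘 q

      [1≡q]+[q≢1] : [1≡q] + [q≢1] ≡ 1
      [1≡q]+[q≢1] = trans (cong (_+ [q≢1]) (bothSize-only-comm 𝟙 q)) (bothSize-only-split q 𝟙)

      [1≡q]+[1≢q] : [1≡q] + [1≢q] ≡ 1
      [1≡q]+[1≢q] = bothSize-only-split 𝟙 q

    commonCount-a : j ≢ 𝟘 → commonCount (aPower j) ≡ k + (k ∸ 2 + 0)
    commonCount-a j≢0 = begin
      commonCount (aPower j)                                                  ≡⟨⟩
      k + (bothSize (allBut 𝟙) (allBut q) + ([0≡p] + ([0≡p] + ([1≡q] + 0))))
        ≡⟨ cong (k +_) (cong₂ _+_ (bothSize-allBut-≢ (moved 𝟙))
                                  (cong₂ _+_ [0≡p]≡0 (cong₂ _+_ [0≡p]≡0 (cong (_+ 0) [1≡q]≡0)))) ⟩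
      k + (k ∸ 2 + 0)                                                         ∎
      where
      open ≡-Reasoning
      moved : ∀ c → c ≢ c ℤₖ.- s
      moved c c≡c-s =
        j≢0 (ℤₖ.⁻¹-injective (trans (Equivalence.to (c≡c-s⇔s≡0 c s) c≡c-s) (sym ℤₖ.ε⁻¹≈ε)))
      [0≡p]≡0 : [0≡p] ≡ 0
      [0≡p]≡0 = bothSize-only-≢ (moved 𝟘)
      [1≡q]≡0 : [1≡q] ≡ 0
      [1≡q]≡0 = bothSize-only-≢ (moved 𝟙)

    commonCount-ad : commonCount (j , false , false , true) ≡ 2
    commonCount-ad = begin
      commonCount (j , false , false , true)   ≡⟨⟩
      [p≢1] + ([0≢q] + ([0≡q] + ([1≡p] + 0)))  ≡⟨ regroup [p≢1] [0≢q] [0≡q] [1≡p] ⟩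
      ([1≡p] + [p≢1]) + ([0≡q] + [0≢q])        ≡⟨ cong₂ _+_ [1≡p]+[p≢1] [0≡q]+[0≢q] ⟩
      2                                        ∎
      where
      open ≡-Reasoning
      regroup : ∀ w x y z → w + (x + (y + (z + 0))) ≡ (z + w) + (y + x)
      regroup = solve-∀

    commonCount-ac : commonCount (j , false , true , false) ≡ 2
    commonCount-ac = begin
      commonCount (j , false , true , false)   ≡⟨⟩
      [p≢1] + ([0≡q] + ([0≢q] + ([1≡p] + 0)))  ≡⟨ regroup [p≢1] [0≡q] [0≢q] [1≡p] ⟩
      ([1≡p] + [p≢1]) + ([0≡q] + [0≢q])        ≡⟨ cong₂ _+_ [1≡p]+[p≢1] [0≡q]+[0≢q] ⟩
      2                                        ∎
      where
      open ≡-Reasoning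
      regroup : ∀ w x y z → w + (x + (y + (z + 0))) ≡ (z + w) + (x + y)
      regroup = solve-∀

    commonCount-acd : commonCount (j , false , true , true) ≡ 2
    commonCount-acd = begin
      commonCount (j , false , true , true)    ≡⟨⟩
      [q≢1] + ([0≡p] + ([0≡p] + ([1≢q] + 0)))  ≡⟨ cong (λ m → [q≢1] + (m + (m + ([1≢q] + 0)))) [0≡p]≡[1≡q] ⟩
      [q≢1] + ([1≡q] + ([1≡q] + ([1≢q] + 0)))  ≡⟨ regroup [q≢1] [1≡q] [1≡q] [1≢q] ⟩
      ([1≡q] + [q≢1]) + ([1≡q] + [1≢q])        ≡⟨ cong₂ _+_ [1≡q]+[q≢1] [1≡q]+[1≢q] ⟩
      2                                        ∎
      where
      open ≡-Reasoning
      regroup : ∀ w x y z → w + (x + (y + (z + 0))) ≡ (x + w) + (y + z)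
      regroup = solve-∀

  order≡ : order Cay ≡ 8 * k
  order≡ = trans (length-cartesianProduct (allFin k) cosets)
                 (trans (cong (_* 8) length-allFin) (ℕ.*-comm k 8))

  degree≡ : ∀ x → degree Cay x ≡ 2 * (k + 1)
  degree≡ x = begin
    count (x ~?_) allG                                               ≡⟨ count-·ʳ (x ~?_) x ⟩
    count (λ z → x ~? (z · x)) allG                                  ≡⟨ count-≐ _ inS? (to , from) allG ⟩
    count inS? allG                                                  ≡⟨ count-slices S-slice (λ _ → always) ⟩
    k + (k ∸ 1 + 3)                                                  ≡⟨ n+[n∸1+3]≡2[n+1] k ⟩
    2 * (k + 1)                                                      ∎
    where
    open ≡-Reasoning
    inS? : Decidable (λ z → InS z × proj₁ z ⊨ always)
    inS? (i , t) = (i ⊨? S-slice t) ×-dec (i ⊨? always)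
    to : ∀ {z} → x ~ (z · x) → InS z × proj₁ z ⊨ always
    to {z} x~ = Equivalence.to (~·self⇔InS x z) x~ , tt
    from : ∀ {z} → InS z × proj₁ z ⊨ always → x ~ (z · x)
    from {z} (inS , _) = Equivalence.from (~·self⇔InS x z) inS

  commonCount-values : 2 ≤ k → ∀ h → h ≢ one → commonCount h ≡ 2 ⊎ commonCount h ≡ 2 * (k ∸ 1)
  commonCount-values 2≤k (j , false , false , false) h≢one =
    inj₂ (trans (commonCount-a j (λ j≡0 → h≢one (cong aPower j≡0))) (n+[n∸2+0]≡2[n∸1] 2≤k))
  commonCount-values _ (j , false , false , true) _ = inj₁ (commonCount-ad j)
  commonCount-values _ (j , false , true , false) _ = inj₁ (commonCount-ac j)
  commonCount-values _ (j , false , true , true) _ = inj₁ (commonCount-acd j)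
  -- When h involves b, each term pairs a slice of a coset without b, which is ∅ or ⟨a⟩, with a
  -- slice of a coset with b; such a count depends only on the shape of the latter, not on j.
  commonCount-values _ (j , true , false , false) _ = inj₁ refl
  commonCount-values _ (j , true , false , true) _ = inj₁ refl
  commonCount-values _ (j , true , true , false) _ = inj₂ refl
  commonCount-values _ (j , true , true , true) _ = inj₁ refl

  commonNbrs-values : 2 ≤ k → ∀ x y → x ≢ y →
                      commonNbrs Cay x y ≡ 2 ⊎ commonNbrs Cay x y ≡ 2 * (k ∸ 1)
  commonNbrs-values 2≤k x y x≢y rewrite commonNbrs≡commonCount x y =
    commonCount-values 2≤k (x · inv y) (λ x/y≡one → x≢y (G.x∙y⁻¹≈ε⇒x≈y x y x/y≡one))

  InS-inv : ∀ w → InS w → InS (inv w)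
  InS-inv (i , true , f , g) inS = inS
  InS-inv (i , false , true , false) _ = tt
  InS-inv (i , false , false , false) ()
  InS-inv (i , false , false , true) ()
  InS-inv (i , false , true , true) ()

  ~-sym : ∀ x y → x ~ y → y ~ x
  ~-sym x y x~y = InS⇒∈S (x · inv y) (subst InS (G.⁻¹-anti-homo-// y x) (InS-inv _ (∈S⇒InS x~y)))

  commonNbrs≢0 : 2 ≤ k → ∀ x y → x ≢ y → commonNbrs Cay x y ≢ 0
  commonNbrs≢0 2≤k x y x≢y with commonNbrs-values 2≤k x y x≢y
  ... | inj₁ ≡2 = λ ≡0 → contradiction (trans (sym ≡2) ≡0) λ ()
  ... | inj₂ ≡2[k∸1] = λ ≡0 → 2[n∸1]≢0 2≤k (trans (sym ≡2[k∸1]) ≡0)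

  distance≤2 : 2 ≤ k → ∀ x y → x ≢ y → x ~ y ⊎ Σ[ z ∈ G ] (x ~ z × z ~ y)
  distance≤2 2≤k x y x≢y with count≢0⇒∃ (λ z → (x ~? z) ×-dec (y ~? z)) allG (commonNbrs≢0 2≤k x y x≢y)
  ... | z , x~z , y~z = inj₂ (z , x~z , ~-sym y z y~z)

  𝟘≢𝟙 : 2 ≤ k → 𝟘 ≢ 𝟙
  𝟘≢𝟙 2≤k 0≡1 = ℕ.0≢1+n (begin
    0         ≡⟨ m<n⇒m%n≡m (>-nonZero⁻¹ k) ⟨
    0 % k     ≡⟨ toℕ-mod 0 ⟨
    toℕ 𝟘     ≡⟨ cong toℕ 0≡1 ⟩
    toℕ 𝟙     ≡⟨ toℕ-mod 1 ⟩
    1 % k     ≡⟨ m<n⇒m%n≡m 2≤k ⟩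
    1         ∎)
    where open ≡-Reasoning

  one≢a : 2 ≤ k → one ≢ a
  one≢a 2≤k one≡a = 𝟘≢𝟙 2≤k (cong proj₁ one≡a)

  one≁a : ¬ one ~ a
  one≁a = ∈S⇒InS

  ∈S⇒one~ : ∀ x → x ∈ S → one ~ x
  ∈S⇒one~ x = subst (_∈ S) (sym (trans (cong (x ·_) G.ε⁻¹≈ε) (G.identityʳ x)))

  notStronglyRegular : 3 ≤ k → ¬ IsStronglyRegular Cay
  notStronglyRegular 3≤k (_ , _ , l , _ , _ , _ , adjacent⇒l , _) = 2≢2[n∸1] 3≤k (begin
    2                            ≡⟨ commonCount-ac (addF 𝟘 (negF 𝟘)) ⟨
    commonCount (one · inv c)    ≡⟨ commonNbrs≡commonCount one c ⟨
    commonNbrs Cay one c         ≡⟨ adjacent⇒l one c (λ ()) (∈S⇒one~ c (InS⇒∈S c tt)) ⟩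
    l                            ≡⟨ adjacent⇒l one (c · b) (λ ())
                                      (∈S⇒one~ (c · b) (InS⇒∈S (c · b) (addF-identityˡ 𝟘))) ⟨
    commonNbrs Cay one (c · b)   ≡⟨ commonNbrs≡commonCount one (c · b) ⟩
    2 * (k ∸ 1)                  ∎)
    where open ≡-Reasoning

lemma3p1 : (k : ℕ) .{{_ : NonZero k}} → 3 ≤ k →
    IsStrictlyDeza (Construction.Cay k) (8 * k) (2 * (k + 1)) (2 * (k ∸ 1)) 2
lemma3p1 k 3≤k =
    (order≡ k , degree≡ k , commonNbrs-values k 2≤k)
  , notStronglyRegular k 3≤k
  , distance≤2 k 2≤k
  , (one , a , one≢a k 2≤k , one≁a k)
  where
  open Construction k using (one; a)
  2≤k : 2 ≤ k
  2≤k = ℕ.<⇒≤ 3≤k
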